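{- Let $\mathbf S$ be a pseudo-model with associated model $\mathbf M=(H,(\sim_b)_{b\in A},V_{\mathbf M})$, and for $B\subseteq A$ let $\sim_B:=\bigcap_{b\in B}\sim_b$ on $H$. Let $B,C\subseteq A$ and $h,h'\in H$ with $h\sim_Bh'$. Then: (1) $last(h)\sim_Blast(h')$ in $\mathbf S$; (2) $last(h)\in\|B\preceq C\|$ iff $last(h')\in\|B\preceq C\|$; (3) if either of the equivalent conditions in (2) holds, then $h\sim_Ch'$.
   Context: Fix a finite set $A$ of agents and a set $Prop$ of atoms. A pseudo-model is $\mathbf S=(S,(\sim_B)_{B\subseteq A},\|\cdot\|)$ with $S$ a set, $\sim_B\subseteq S\times S$, and $\|\cdot\|$ assigning subsets of $S$ to each $p\in Prop$ and each symbol $B\preceq C$ ($B,C\subseteq A$), such that: (1) each $\sim_B$ is an equivalence relation; (2) if $s\in\|B\preceq C\|$ and $s\sim_Bt$ then $s\sim_Ct$ and $t\in\|B\preceq C\|$; (3) $\|B\preceq C\|=S$ if $C\subseteq B$; (4) $\|B\preceq C\|\cap\|B\preceq E\|\subseteq\|B\preceq C\cup E\|$; (5) $\|B\preceq C\|\cap\|C\preceq E\|\subseteq\|B\preceq E\|$. Associated model: $H$ is the set of all finite sequences (histories) $h=(s_0,B^1,s_1,\dots,B^n,s_n)$ with $n\ge0$, $s_k\in S$, $B^k\subseteq A$, $s_{k-1}\sim_{B^k}s_k$; $last(h):=s_n$. Write $h\to_Bh'$ iff $h'=(h,B,s')$ ($h$ extended by $B,s'$) for some $s'$. Write $h\stackrel{\sim}{\to}_Bh'$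 iff $h\to_{B'}h'$ for some $B'\subseteq A$ with $last(h)\in\|B'\preceq B\|$. For $b\in A$, $\sim_b\subseteq H\times H$ is the smallest equivalence relation containing $\stackrel{\sim}{\to}_{\{b\}}$. $V_{\mathbf M}(p):=\{h:last(h)\in\|p\|\}$. -}

module Defs where

open import Level using (0ℓ)
open import Data.Nat using (ℕ)
open import Data.Fin using (Fin)
open import Data.Fin.Subset using (Subset; _∈_; _⊆_; _∪_; ⁅_⁆)
open import Data.Product using (Σ; ∃; _×_; _,_)
open import Relation.Binary using (Rel; IsEquivalence)
open import Relation.Binary.PropositionalEquality using (_≡_)
open import Relation.Binary.Construct.Closure.Equivalence using (EqClosure)

-- Agents: A = Fin n; groups of agents B ⊆ A: Subset n.
-- Atoms: an arbitrary type Atom.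
record PseudoModel (n : ℕ) (Atom : Set) : Set₁ where
  field
    S     : Set
    rel   : Subset n → Rel S 0ℓ
    val   : Atom → S → Set
    pre   : Subset n → Subset n → S → Set       -- ‖B ⪯ C‖ (as a predicate on S)
    rel-equiv : ∀ B → IsEquivalence (rel B)
    pre-rel   : ∀ B C s t → pre B C s → rel B s t → rel C s t × pre B C t
    pre-sub   : ∀ B C → C ⊆ B → ∀ s → pre B C s
    pre-union : ∀ B C E s → pre B C s → pre B E s → pre B (C ∪ E) s
    pre-trans : ∀ B C E s → pre B C s → pre C E s → pre B E s

module AssociatedModel {n : ℕ} {Atom : Set} (𝐒 : PseudoModel n Atom) where
  open PseudoModel 𝐒

  -- raw finite sequences (s₀, B¹, s₁, …, Bⁿ, sₙ)
  data Seq : Set where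
    start : S → Seq
    snoc  : Seq → Subset n → S → Seq

  last : Seq → S
  last (start s)    = s
  last (snoc h B s) = s

  data IsHistory : Seq → Set where
    start : ∀ s → IsHistory (start s)
    snoc  : ∀ {h} B s' → IsHistory h → rel B (last h) s' → IsHistory (snoc h B s')

  H : Set
  H = Σ Seq IsHistory

  lastH : H → S
  lastH (h , _) = last h

  _→[_]_ : H → Subset n → H → Set
  (h , _) →[ B ] (h' , _) = ∃ λ s' → h' ≡ snoc h B s'

  _~→[_]_ : H → Subset n → H → Set
  h ~→[ B ] h' = ∃ λ B' → (h →[ B' ] h') × pre B' B (lastH h)

  _∼[_]ᵃ_ : H → Fin n → H → Set
  h ∼[ b ]ᵃ h' = EqClosure (λ x y → x ~→[ ⁅ b ⁆ ] y) h h'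

  _∼[_]ᴴ_ : H → Subset n → H → Set
  h ∼[ B ]ᴴ h' = ∀ b → b ∈ B → h ∼[ b ]ᵃ h'

  V : Atom → H → Set
  V p h = val p (lastH h)

-- The histories of the associated model form a forest, and every generating edge
-- h ~→_b h' appends one step to h.  Hence two b-equivalent histories have a common
-- prefix k from which both are reached by steps (x, B', s) with last x ∈ ‖B' ⪯ {b}‖.
-- Prefixes of a history are linearly ordered by length, so the longest of these prefixes
-- (one for each b ∈ B) serves all b at once, and closure of ‖B' ⪯ ·‖ under unions turns
-- its steps into steps with last x ∈ ‖B' ⪯ B‖.  Along such steps ∼_B is preserved in S,
-- which gives (1) and then (2); ‖B ⪯ C‖ is preserved as well, so every such step is a
-- c-edge for each c ∈ C, and the two paths through k give (3).
module Submission where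

open import Defs
open import Level using (0ℓ)
open import Data.Nat using (ℕ; suc; _≤_)
open import Data.Nat.Properties using (≤-refl; ≤-trans; ≤-total; m≤n⇒m≤1+n; 1+n≰n)
open import Data.Fin using (Fin)
open import Data.Fin.Subset using (Subset; Nonempty; _∈_; _⊆_; ⁅_⁆; ⊥; ⋃)
open import Data.Fin.Subset.Properties using (_∈?_; x∈⁅x⁆; x∈⁅y⁆⇒x≡y; x∈p∪q⁺; ⊥⊆)
open import Data.List using (List; []; _∷_; map; filter; allFin)
open import Data.List.Relation.Unary.Any using (here; there)
open import Data.List.Relation.Unary.All as All using (All; []; _∷_)
open import Data.List.Relation.Unary.All.Properties using (map⁺; tabulate⁺; tabulate⁻)
open import Data.List.Membership.Propositional using () renaming (_∈_ to _∈ₗ_)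
open import Data.List.Membership.Propositional.Properties
  using (∈-map⁺; ∈-filter⁺; ∈-filter⁻; ∈-allFin)
open import Data.Product using (∃; _×_; _,_; proj₁; proj₂; swap)
open import Data.Sum using (inj₁; inj₂)
open import Data.Unit using (⊤)
open import Function.Bundles using (_⇔_; mk⇔)
open import Relation.Nullary using (yes; no; contradiction)
open import Relation.Binary using (REL; IsEquivalence)
open import Relation.Binary.Construct.Constant using (Const)
open import Relation.Binary.Construct.Intersection using (_∩_)
open import Relation.Binary.PropositionalEquality using (_≡_; refl)
open import Relation.Binary.Construct.Closure.ReflexiveTransitive using (ε; _◅_; _◅◅_)
open import Relation.Binary.Construct.Closure.Symmetric using (SymClosure; fwd; bwd)
open import Relation.Binary.Construct.Closure.Equivalence using (EqClosure; symmetric)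

module _ {n : ℕ} where

  ∈-⋃⁺ : ∀ {x : Fin n} {X Xs} → x ∈ X → X ∈ₗ Xs → x ∈ ⋃ Xs
  ∈-⋃⁺ x∈X (here refl)  = x∈p∪q⁺ (inj₁ x∈X)
  ∈-⋃⁺ x∈X (there X∈Xs) = x∈p∪q⁺ (inj₂ (∈-⋃⁺ x∈X X∈Xs))

  x∈p⇒⁅x⁆⊆p : ∀ {x : Fin n} {p} → x ∈ p → ⁅ x ⁆ ⊆ p
  x∈p⇒⁅x⁆⊆p {x} x∈p y∈⁅x⁆ with refl ← x∈⁅y⁆⇒x≡y x y∈⁅x⁆ = x∈p

module Histories {n : ℕ} {Atom : Set} (𝐒 : PseudoModel n Atom) where
  open PseudoModel 𝐒
  open AssociatedModel 𝐒
  module R (B : Subset n) = IsEquivalence (rel-equiv B)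

  pre-⋃ : ∀ {B s} Xs → All (λ X → pre B X s) Xs → pre B (⋃ Xs) s
  pre-⋃ []       []       = pre-sub _ ⊥ ⊥⊆ _
  pre-⋃ (X ∷ Xs) (p ∷ ps) = pre-union _ X (⋃ Xs) _ p (pre-⋃ Xs ps)

  pre-from-singletons : ∀ {B C s} → (∀ c → c ∈ C → pre B ⁅ c ⁆ s) → pre B C s
  pre-from-singletons {B} {C} {s} pre-⁅c⁆ =
    pre-trans B (⋃ singletons) C s
      (pre-⋃ singletons (map⁺ (All.tabulate pre-⁅member⁆)))
      (pre-sub (⋃ singletons) C C⊆⋃singletons s)
    where
      members : List (Fin n)
      members = filter (_∈? C) (allFin n)
      singletons : List (Subset n)
      singletons = map ⁅_⁆ members
      pre-⁅member⁆ : ∀ {c} → c ∈ₗ members → pre B ⁅ c ⁆ s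
      pre-⁅member⁆ c∈members = pre-⁅c⁆ _ (proj₂ (∈-filter⁻ (_∈? C) {xs = allFin n} c∈members))
      C⊆⋃singletons : C ⊆ ⋃ singletons
      C⊆⋃singletons {c} c∈C =
        ∈-⋃⁺ (x∈⁅x⁆ c) (∈-map⁺ ⁅_⁆ (∈-filter⁺ (_∈? C) (∈-allFin c) c∈C))

  length : Seq → ℕ
  length (start _)    = 0
  length (snoc h _ _) = suc (length h)

  StepPred : Set₁
  StepPred = REL Seq (Subset n) 0ℓ

  infix 4 _⊑⟨_⟩_
  data _⊑⟨_⟩_ (k : Seq) (P : StepPred) : Seq → Set where
    ⊑-refl : k ⊑⟨ P ⟩ k
    ⊑-snoc : ∀ {h B s} → k ⊑⟨ P ⟩ h → P h B → k ⊑⟨ P ⟩ snoc h B s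

  ⊑-map : ∀ {P Q k h} → (∀ {x B} → P x B → Q x B) → k ⊑⟨ P ⟩ h → k ⊑⟨ Q ⟩ h
  ⊑-map f ⊑-refl         = ⊑-refl
  ⊑-map f (⊑-snoc k⊑h p) = ⊑-snoc (⊑-map f k⊑h) (f p)

  ⊑-length : ∀ {P k h} → k ⊑⟨ P ⟩ h → length k ≤ length h
  ⊑-length ⊑-refl         = ≤-refl
  ⊑-length (⊑-snoc k⊑h _) = m≤n⇒m≤1+n (⊑-length k⊑h)

  ⊑-unsnoc : ∀ {P k B s h} → P k B → snoc k B s ⊑⟨ P ⟩ h → k ⊑⟨ P ⟩ h
  ⊑-unsnoc p ⊑-refl         = ⊑-snoc ⊑-refl p
  ⊑-unsnoc p (⊑-snoc k⊑h q) = ⊑-snoc (⊑-unsnoc p k⊑h) q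

  ⊑-deeper : ∀ {P Q k k' h} → k ⊑⟨ P ⟩ h → k' ⊑⟨ Q ⟩ h → length k ≤ length k' →
             k' ⊑⟨ P ∩ Q ⟩ h
  ⊑-deeper _ ⊑-refl _ = ⊑-refl
  ⊑-deeper ⊑-refl (⊑-snoc k'⊑h _) k≤k' =
    contradiction (≤-trans k≤k' (⊑-length k'⊑h)) 1+n≰n
  ⊑-deeper (⊑-snoc k⊑h p) (⊑-snoc k'⊑h q) k≤k' = ⊑-snoc (⊑-deeper k⊑h k'⊑h k≤k') (p , q)

  ⊑-history : ∀ {P k h} → k ⊑⟨ P ⟩ h → IsHistory h → IsHistory k
  ⊑-history ⊑-refl         ph                = ph
  ⊑-history (⊑-snoc k⊑h _) (snoc _ _ ph _) = ⊑-history k⊑h ph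

  CommonPrefix : StepPred → Seq → Seq → Set
  CommonPrefix P h h' = ∃ λ k → k ⊑⟨ P ⟩ h × k ⊑⟨ P ⟩ h'

  module _ {h h' : Seq} where

    CommonPrefix-map : ∀ {P Q} → (∀ {x B} → P x B → Q x B) →
                       CommonPrefix P h h' → CommonPrefix Q h h'
    CommonPrefix-map f (k , k⊑h , k⊑h') = k , ⊑-map f k⊑h , ⊑-map f k⊑h'

    CommonPrefix-∩ : ∀ {P Q} → CommonPrefix P h h' → CommonPrefix Q h h' →
                     CommonPrefix (P ∩ Q) h h'
    CommonPrefix-∩ (k , k⊑h , k⊑h') (l , l⊑h , l⊑h') with ≤-total (length k) (length l)
    ... | inj₁ k≤l = l , ⊑-deeper k⊑h l⊑h k≤l , ⊑-deeper k⊑h' l⊑h' k≤l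
    ... | inj₂ l≤k = k , ⊑-map swap (⊑-deeper l⊑h k⊑h l≤k) , ⊑-map swap (⊑-deeper l⊑h' k⊑h' l≤k)

    CommonPrefix-All : ∀ {I : Set} (Ps : I → StepPred) L → CommonPrefix (Const ⊤) h h' →
                       All (λ i → CommonPrefix (Ps i) h h') L →
                       CommonPrefix (λ x B → All (λ i → Ps i x B) L) h h'
    CommonPrefix-All Ps []      c []         = CommonPrefix-map (λ _ → []) c
    CommonPrefix-All Ps (i ∷ L) c (cᵢ ∷ cs) =
      CommonPrefix-map (λ (p , ps) → p ∷ ps) (CommonPrefix-∩ cᵢ (CommonPrefix-All Ps L c cs))

  AgentStep : Fin n → StepPred
  AgentStep b x B' = pre B' ⁅ b ⁆ (last x)

  GroupStep : Subset n → StepPred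
  GroupStep B x B' = pre B' B (last x)

  CommonPrefix-edge : ∀ {b h₀} {x y : H} → CommonPrefix (AgentStep b) h₀ (proj₁ x) →
                      SymClosure _~→[ ⁅ b ⁆ ]_ x y → CommonPrefix (AgentStep b) h₀ (proj₁ y)
  CommonPrefix-edge {x = _ , _} {y = _ , _} (k , k⊑h₀ , k⊑x) (fwd (_ , (_ , refl) , p)) =
    k , k⊑h₀ , ⊑-snoc k⊑x p
  CommonPrefix-edge {y = y , _} (_ , k⊑h₀ , ⊑-refl) (bwd (_ , (_ , refl) , p)) =
    y , ⊑-unsnoc p k⊑h₀ , ⊑-refl
  CommonPrefix-edge {y = _ , _} (k , k⊑h₀ , ⊑-snoc k⊑y _) (bwd (_ , (_ , refl) , _)) =
    k , k⊑h₀ , k⊑y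

  CommonPrefix-path : ∀ {b h₀} {x y : H} → CommonPrefix (AgentStep b) h₀ (proj₁ x) →
                      EqClosure _~→[ ⁅ b ⁆ ]_ x y → CommonPrefix (AgentStep b) h₀ (proj₁ y)
  CommonPrefix-path c ε           = c
  CommonPrefix-path c (e ◅ path) = CommonPrefix-path (CommonPrefix-edge c e) path

  ∼ᵃ⇒CommonPrefix : ∀ {b} {h h' : H} → h ∼[ b ]ᵃ h' →
                    CommonPrefix (AgentStep b) (proj₁ h) (proj₁ h')
  ∼ᵃ⇒CommonPrefix = CommonPrefix-path (_ , ⊑-refl , ⊑-refl)

  ∼ᴴ⇒CommonPrefix : ∀ {B} {h h' : H} → Nonempty B → h ∼[ B ]ᴴ h' →
                    CommonPrefix (GroupStep B) (proj₁ h) (proj₁ h')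
  ∼ᴴ⇒CommonPrefix {B} {h} {h'} (b₀ , b₀∈B) h∼h' =
    CommonPrefix-map (λ ps → pre-from-singletons (tabulate⁻ ps))
      (CommonPrefix-All Guarded (allFin n) any-prefix (tabulate⁺ guarded-prefix))
    where
      Guarded : Fin n → StepPred
      Guarded b x B' = b ∈ B → AgentStep b x B'
      any-prefix : CommonPrefix (Const ⊤) (proj₁ h) (proj₁ h')
      any-prefix = CommonPrefix-map _ (∼ᵃ⇒CommonPrefix (h∼h' b₀ b₀∈B))
      guarded-prefix : ∀ b → CommonPrefix (Guarded b) (proj₁ h) (proj₁ h')
      guarded-prefix b with b ∈? B
      ... | yes b∈B = CommonPrefix-map (λ p _ → p) (∼ᵃ⇒CommonPrefix (h∼h' b b∈B))
      ... | no  b∉B = CommonPrefix-map (λ _ b∈B → contradiction b∈B b∉B) any-prefix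

  ⊑-rel : ∀ {B k h} → k ⊑⟨ GroupStep B ⟩ h → IsHistory h → rel B (last k) (last h)
  ⊑-rel {B} ⊑-refl _ = R.refl B
  ⊑-rel {B} (⊑-snoc k⊑x p) (snoc B' s px x∼s) =
    R.trans B (⊑-rel k⊑x px) (proj₁ (pre-rel B' B _ s p x∼s))

  -- Well-formedness proofs of a sequence need not be unique, so two histories with the
  -- same underlying sequence are linked by a detour through a one-step extension.
  same-seq-∼ᵃ : ∀ {c h} (p q : IsHistory h) → (h , p) ∼[ c ]ᵃ (h , q)
  same-seq-∼ᵃ {c} {h} p q = _◅_ {j = extension} (fwd edge) (bwd edge ◅ ε)
    where
      extension : H
      extension = snoc h ⁅ c ⁆ (last h) , snoc ⁅ c ⁆ (last h) p (R.refl ⁅ c ⁆)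
      edge : ∃ λ B' → (∃ λ s' → proj₁ extension ≡ snoc h B' s') × pre B' ⁅ c ⁆ (last h)
      edge = ⁅ c ⁆ , (last h , refl) , pre-sub ⁅ c ⁆ ⁅ c ⁆ (λ c∈ → c∈) (last h)

  ⊑⇒∼ᵃ : ∀ {B C c k h} → c ∈ C → pre B C (last k) → k ⊑⟨ GroupStep B ⟩ h →
         (pk : IsHistory k) (ph : IsHistory h) → (k , pk) ∼[ c ]ᵃ (h , ph)
  ⊑⇒∼ᵃ c∈C k∈BC ⊑-refl pk ph = same-seq-∼ᵃ pk ph
  ⊑⇒∼ᵃ {B} {C} {c} c∈C k∈BC (⊑-snoc {x} {B'} {s} k⊑x x∈B'B) pk (snoc _ _ px _) =
    ⊑⇒∼ᵃ c∈C k∈BC k⊑x pk px ◅◅ fwd (B' , (s , refl) , x∈B'c) ◅ ε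
    where
      x∈BC : pre B C (last x)
      x∈BC = proj₂ (pre-rel B C _ _ k∈BC (⊑-rel k⊑x px))
      x∈B'c : pre B' ⁅ c ⁆ (last x)
      x∈B'c = pre-trans B' C ⁅ c ⁆ _ (pre-trans B' B C _ x∈B'B x∈BC)
                (pre-sub C ⁅ c ⁆ (x∈p⇒⁅x⁆⊆p c∈C) _)

lemma5 : ∀ {n : ℕ} {Atom : Set} (𝐒 : PseudoModel n Atom) →
    let open PseudoModel 𝐒
        open AssociatedModel 𝐒
    in ∀ (B C : Subset n) (h h' : H) → Nonempty B → h ∼[ B ]ᴴ h' →
         rel B (lastH h) (lastH h')
         × (pre B C (lastH h) ⇔ pre B C (lastH h'))
         × (pre B C (lastH h) → h ∼[ C ]ᴴ h')
lemma5 𝐒 B C (h , ph) (h' , ph') B≢∅ h∼h' =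
  through (∼ᴴ⇒CommonPrefix B≢∅ h∼h')
  where
    open PseudoModel 𝐒
    open AssociatedModel 𝐒
    open Histories 𝐒

    transport : ∀ {s t} → rel B s t → pre B C s → pre B C t
    transport s∼t s∈BC = proj₂ (pre-rel B C _ _ s∈BC s∼t)

    through : CommonPrefix (GroupStep B) h h' →
              rel B (last h) (last h')
              × (pre B C (last h) ⇔ pre B C (last h'))
              × (pre B C (last h) → (h , ph) ∼[ C ]ᴴ (h' , ph'))
    through (k , k⊑h , k⊑h') =
      h∼h'-in-S , mk⇔ (transport h∼h'-in-S) (transport (R.sym B h∼h'-in-S)) , ∼ᴴ-over-C
      where
        k∼h : rel B (last k) (last h)
        k∼h = ⊑-rel k⊑h ph
        h∼h'-in-S : rel B (last h) (last h')
        h∼h'-in-S = R.trans B (R.sym B k∼h) (⊑-rel k⊑h' ph')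
        ∼ᴴ-over-C : pre B C (last h) → (h , ph) ∼[ C ]ᴴ (h' , ph')
        ∼ᴴ-over-C h∈BC c c∈C =
          symmetric _ (⊑⇒∼ᵃ c∈C k∈BC k⊑h pk ph) ◅◅ ⊑⇒∼ᵃ c∈C k∈BC k⊑h' pk ph'
          where
            pk : IsHistory k
            pk = ⊑-history k⊑h ph
            k∈BC : pre B C (last k)
            k∈BC = transport (R.sym B k∼h) h∈BC
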